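{- Let $n \ge 3$ be an integer. If $M(n) = 0$, then there exists a divisor $d$ of $n^2$ with $d \neq n^2$ such that $d\,\tau(d) \ge n^2$.
   Context: For an integer $n \ge 3$, consider tilings of an $n \times n$ square by finitely many, and at least two, rectangles with integer side lengths which are pairwise incongruent (two rectangles are congruent if they have the same pair of side lengths, up to rotation). The score of such a tiling is the area of its largest rectangle minus the area of its smallest rectangle. $M(n)$ is the minimum score over all such tilings of the $n \times n$ square. For a positive integer $d$, $\tau(d)$ denotes the number of positive divisors of $d$. -}

module Defs where

open import Data.Nat using (ℕ; suc; _+_; _*_; _∸_; _≤_; _<_)
open import Data.Nat.Divisibility using (_∣?_)
open import Data.List using (List; length; filter; map; upTo)
open import Data.Fin using (Fin)
open import Data.Product using (Σ; ∃; _×_)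
open import Data.Sum using (_⊎_)
open import Relation.Binary.PropositionalEquality using (_≡_; _≢_)
open import Relation.Nullary using (¬_)

-- An axis-parallel rectangle with lower-left corner (x , y), width w, height h.
record Rect : Set where
  constructor rect
  field
    x y w h : ℕ

open Rect public

area : Rect → ℕ
area r = w r * h r

-- unit cell [i,i+1]×[j,j+1] lies in r
covers : Rect → ℕ → ℕ → Set
covers r i j = (x r ≤ i × i < x r + w r) × (y r ≤ j × j < y r + h r)

Congruent : Rect → Rect → Set
Congruent r s = (w r ≡ w s × h r ≡ h s) ⊎ (w r ≡ h s × h r ≡ w s)

record Tiling (n : ℕ) : Set where
  field
    k        : ℕ
    rects    : Fin k → Rect
    atLeast2 : 2 ≤ k
    positive : ∀ a → 1 ≤ w (rects a) × 1 ≤ h (rects a)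
    inside   : ∀ a → x (rects a) + w (rects a) ≤ n × y (rects a) + h (rects a) ≤ n
    cover    : ∀ i j → i < n → j < n → ∃ λ a → covers (rects a) i j
    disjoint : ∀ a b → a ≢ b → ∀ i j → ¬ (covers (rects a) i j × covers (rects b) i j)
    incongruent : ∀ a b → a ≢ b → ¬ Congruent (rects a) (rects b)

open Tiling public

IsScore : ∀ {n} → Tiling n → ℕ → Set
IsScore t s = Σ (Fin (k t)) λ a → Σ (Fin (k t)) λ b →
  (∀ c → area (rects t c) ≤ area (rects t a)) ×
  (∀ c → area (rects t b) ≤ area (rects t c)) ×
  s ≡ area (rects t a) ∸ area (rects t b)

MIs : ℕ → ℕ → Set
MIs n m = (Σ (Tiling n) λ t → IsScore t m) ×
          (∀ (t : Tiling n) s → IsScore t s → m ≤ s)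

τ : ℕ → ℕ
τ d = length (filter (λ e → e ∣? d) (map suc (upTo d)))

{-# OPTIONS --safe #-}
-- If the score is 0 then all k ≥ 2 rectangles have the same area A, so counting unit cells
-- gives n² = k A; in particular A is a proper divisor of n². Two rectangles of area A with
-- the same width would be congruent, so their widths are k distinct divisors of A, whence
-- k ≤ τ(A) and n² = k A ≤ A τ(A).
module Submission where

open import Defs
open import Data.Nat using (ℕ; zero; suc; _*_; _+_; _≤_; _<_; z≤n; s≤s; NonZero; >-nonZero; ≢-nonZero⁻¹)
open import Data.Nat.Properties
open import Data.Nat.Divisibility using (_∣_; _∣?_; divides; ∣⇒≤; 0∣⇒≡0; m∣m*n)
open import Data.Fin using (Fin; toℕ; punchIn)
open import Data.Fin.Properties using (punchInᵢ≢i; injective⇒≤; toℕ<n) renaming (_≟_ to _≟ᶠ_)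
open import Data.List using (List; filter; map; upTo)
open import Data.List.Membership.Propositional using (_∈_)
open import Data.List.Membership.Propositional.Properties using (∈-filter⁺; ∈-map⁺; ∈-upTo⁺)
open import Data.List.Membership.Setoid.Properties using (index-injective)
open import Data.Product using (∃; _×_; _,_; proj₁; proj₂)
open import Data.Sum using (inj₁)
open import Function using (_∘_)
open import Function.Definitions using (Injective)
open import Relation.Nullary using (¬_; yes; no; contradiction)
open import Relation.Nullary.Decidable using (_×-dec_)
open import Relation.Binary.PropositionalEquality
open import Algebra.Properties.Semiring.Sum +-*-semiring

sum-const : ∀ n c → ∑[ i < n ] c ≡ n * c
sum-const zero    c = refl
sum-const (suc n) c = cong (c +_) (sum-const n c)

sum-single : ∀ {k} (f : Fin k → ℕ) a → (∀ b → b ≢ a → f b ≡ 0) → sum f ≡ f a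
sum-single {suc k} f a f≡0 = begin
  sum f                            ≡⟨ sum-remove f ⟩
  f a + ∑[ b < k ] f (punchIn a b) ≡⟨ cong (f a +_) (sum-cong-≗ λ b → f≡0 _ (punchInᵢ≢i a b)) ⟩
  f a + ∑[ b < k ] 0               ≡⟨ cong (f a +_) (sum-replicate-zero k) ⟩
  f a + 0                          ≡⟨ +-identityʳ (f a) ⟩
  f a                              ∎
  where open ≡-Reasoning

intervalIndicator : ℕ → ℕ → ℕ → ℕ
intervalIndicator zero    zero    i       = 0
intervalIndicator zero    (suc w) zero    = 1
intervalIndicator zero    (suc w) (suc i) = intervalIndicator zero w i
intervalIndicator (suc x) w       zero    = 0
intervalIndicator (suc x) w       (suc i) = intervalIndicator x w i

intervalIndicator-inside : ∀ x w {i} → x ≤ i → i < x + w → intervalIndicator x w i ≡ 1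
intervalIndicator-inside zero    (suc w) {zero}  _         _         = refl
intervalIndicator-inside zero    (suc w) {suc i} _         (s≤s i<w) =
  intervalIndicator-inside zero w z≤n i<w
intervalIndicator-inside (suc x) w       {suc i} (s≤s x≤i) (s≤s i<x+w) =
  intervalIndicator-inside x w x≤i i<x+w

intervalIndicator-outside : ∀ x w {i} → ¬ (x ≤ i × i < x + w) → intervalIndicator x w i ≡ 0
intervalIndicator-outside zero    zero    {i}     _   = refl
intervalIndicator-outside zero    (suc w) {zero}  out = contradiction (z≤n , s≤s z≤n) out
intervalIndicator-outside zero    (suc w) {suc i} out =
  intervalIndicator-outside zero w λ (_ , i<w) → out (z≤n , s≤s i<w)
intervalIndicator-outside (suc x) w       {zero}  _   = refl
intervalIndicator-outside (suc x) w       {suc i} out =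
  intervalIndicator-outside x w λ (x≤i , i<x+w) → out (s≤s x≤i , s≤s i<x+w)

∑-intervalIndicator : ∀ {n} x w → x + w ≤ n → ∑[ i < n ] intervalIndicator x w (toℕ i) ≡ w
∑-intervalIndicator {n}     zero    zero    _           = sum-replicate-zero n
∑-intervalIndicator {suc n} zero    (suc w) (s≤s w≤n)   = cong suc (∑-intervalIndicator zero w w≤n)
∑-intervalIndicator {suc n} (suc x) w       (s≤s x+w≤n) = ∑-intervalIndicator x w x+w≤n

cellIndicator : Rect → ℕ → ℕ → ℕ
cellIndicator r i j = intervalIndicator (x r) (w r) i * intervalIndicator (y r) (h r) j

cellIndicator-covers : ∀ r {i j} → covers r i j → cellIndicator r i j ≡ 1
cellIndicator-covers r ((x≤i , i<x+w) , (y≤j , j<y+h)) =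
  cong₂ _*_ (intervalIndicator-inside (x r) (w r) x≤i i<x+w)
            (intervalIndicator-inside (y r) (h r) y≤j j<y+h)

cellIndicator-¬covers : ∀ r {i j} → ¬ covers r i j → cellIndicator r i j ≡ 0
cellIndicator-¬covers r {i} {j} ¬cov with (x r ≤? i) ×-dec (i <? x r + w r)
... | no  ¬inX = cong (_* intervalIndicator (y r) (h r) j)
                      (intervalIndicator-outside (x r) (w r) ¬inX)
... | yes inX  = trans (cong (intervalIndicator (x r) (w r) i *_)
                             (intervalIndicator-outside (y r) (h r) λ inY → ¬cov (inX , inY)))
                       (*-zeroʳ (intervalIndicator (x r) (w r) i))

∑∑-cellIndicator : ∀ {n} r → x r + w r ≤ n → y r + h r ≤ n →
                   ∑[ i < n ] ∑[ j < n ] cellIndicator r (toℕ i) (toℕ j) ≡ area r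
∑∑-cellIndicator {n} r x+w≤n y+h≤n = begin
  ∑[ i < n ] ∑[ j < n ] (X (toℕ i) * Y (toℕ j))
    ≡⟨ sum-cong-≗ {n} (λ i → *-distribˡ-sum {n} (X (toℕ i)) (Y ∘ toℕ)) ⟨
  ∑[ i < n ] (X (toℕ i) * ∑[ j < n ] Y (toℕ j))
    ≡⟨ *-distribʳ-sum {n} (∑[ j < n ] Y (toℕ j)) (X ∘ toℕ) ⟨
  (∑[ i < n ] X (toℕ i)) * (∑[ j < n ] Y (toℕ j))
    ≡⟨ cong₂ _*_ (∑-intervalIndicator {n} (x r) (w r) x+w≤n)
                 (∑-intervalIndicator {n} (y r) (h r) y+h≤n) ⟩
  w r * h r
    ∎
  where
  open ≡-Reasoning
  X Y : ℕ → ℕ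
  X = intervalIndicator (x r) (w r)
  Y = intervalIndicator (y r) (h r)

divisors : ℕ → List ℕ
divisors A = filter (_∣? A) (map suc (upTo A))

∣⇒∈divisors : ∀ {A d} .{{_ : NonZero A}} → d ∣ A → d ∈ divisors A
∣⇒∈divisors {A} {zero}  0∣A = contradiction (0∣⇒≡0 0∣A) (≢-nonZero⁻¹ A)
∣⇒∈divisors {A} {suc d} d∣A = ∈-filter⁺ (_∣? A) (∈-map⁺ suc (∈-upTo⁺ (∣⇒≤ d∣A))) d∣A

distinct-divisors≤τ : ∀ {k A} .{{_ : NonZero A}} (f : Fin k → ℕ) →
                      Injective _≡_ _≡_ f → (∀ a → f a ∣ A) → k ≤ τ A
distinct-divisors≤τ f f-inj f∣A = injective⇒≤ λ {a} {b} eq →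
  f-inj (index-injective (setoid ℕ) (∣⇒∈divisors (f∣A a)) (∣⇒∈divisors (f∣A b)) eq)

module _ {n} (t : Tiling n) where

  private
    R : Fin (k t) → Rect
    R = rects t

  instance
    width-nonZero : ∀ {a} → NonZero (w (R a))
    width-nonZero {a} = >-nonZero (proj₁ (positive t a))

    height-nonZero : ∀ {a} → NonZero (h (R a))
    height-nonZero {a} = >-nonZero (proj₂ (positive t a))

  area-nonZero : ∀ a → NonZero (area (R a))
  area-nonZero a = m*n≢0 (w (R a)) (h (R a))

  ∑-cellIndicator-tiles : ∀ {i j} → i < n → j < n → ∑[ a < k t ] cellIndicator (R a) i j ≡ 1
  ∑-cellIndicator-tiles {i} {j} i<n j<n with a , cov ← cover t i j i<n j<n =
    trans (sum-single (λ b → cellIndicator (R b) i j) a λ b b≢a →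
             cellIndicator-¬covers (R b) λ covᵇ → disjoint t b a b≢a i j (covᵇ , cov))
          (cellIndicator-covers (R a) cov)

  tiling-area : n * n ≡ ∑[ a < k t ] area (R a)
  tiling-area = begin
    n * n
      ≡⟨ sum-const n n ⟨
    ∑[ i < n ] n
      ≡⟨ sum-cong-≗ {n} (λ _ → trans (sum-const n 1) (*-identityʳ n)) ⟨
    ∑[ i < n ] ∑[ j < n ] 1
      ≡⟨ sum-cong-≗ {n} (λ i → sum-cong-≗ {n} λ j → ∑-cellIndicator-tiles (toℕ<n i) (toℕ<n j)) ⟨
    ∑[ i < n ] ∑[ j < n ] ∑[ a < k t ] χ a i j
      ≡⟨ sum-cong-≗ {n} (λ i → ∑-comm (λ j a → χ a i j)) ⟩
    ∑[ i < n ] ∑[ a < k t ] ∑[ j < n ] χ a i j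
      ≡⟨ ∑-comm (λ i a → ∑[ j < n ] χ a i j) ⟩
    ∑[ a < k t ] ∑[ i < n ] ∑[ j < n ] χ a i j
      ≡⟨ sum-cong-≗ {k t} (λ a → ∑∑-cellIndicator (R a) (proj₁ (inside t a)) (proj₂ (inside t a))) ⟩
    ∑[ a < k t ] area (R a)
      ∎
    where
    open ≡-Reasoning
    χ : Fin (k t) → Fin n → Fin n → ℕ
    χ a i j = cellIndicator (R a) (toℕ i) (toℕ j)

  score-zero⇒equal-areas : IsScore t 0 → ∃ λ a → ∀ c → area (R c) ≡ area (R a)
  score-zero⇒equal-areas (a , b , largest , smallest , 0≡a∸b) =
    a , λ c → ≤-antisym (largest c) (≤-trans (m∸n≡0⇒m≤n (sym 0≡a∸b)) (smallest c))

  equal-areas⇒widths-injective : ∀ {A} → (∀ a → area (R a) ≡ A) → Injective _≡_ _≡_ (w ∘ R)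
  equal-areas⇒widths-injective equal {a} {b} wa≡wb with a ≟ᶠ b
  ... | yes a≡b = a≡b
  ... | no  a≢b = contradiction (inj₁ (wa≡wb , ha≡hb)) (incongruent t a b a≢b)
    where
    ha≡hb : h (R a) ≡ h (R b)
    ha≡hb = *-cancelˡ-≡ (h (R a)) (h (R b)) (w (R a))
              (trans (equal a) (trans (sym (equal b)) (cong (_* h (R b)) (sym wa≡wb))))

  equal-areas⇒k≤τ : ∀ {A} .{{_ : NonZero A}} → (∀ a → area (R a) ≡ A) → k t ≤ τ A
  equal-areas⇒k≤τ equal = distinct-divisors≤τ (w ∘ R) (equal-areas⇒widths-injective equal)
    λ a → subst (w (R a) ∣_) (equal a) (m∣m*n (h (R a)))

proposition1 : (n : ℕ) → 3 ≤ n → MIs n 0 →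
    ∃ λ d → d ∣ n * n × d ≢ n * n × n * n ≤ d * τ d
proposition1 n _ ((t , score-zero) , _) with a , equal ← score-zero⇒equal-areas t score-zero =
  A , divides (k t) n²≡kA , A≢n² , n²≤Aτ
  where
  A : ℕ
  A = area (rects t a)
  instance
    A-nonZero : NonZero A
    A-nonZero = area-nonZero t a

  n²≡kA : n * n ≡ k t * A
  n²≡kA = trans (tiling-area t) (trans (sum-cong-≗ {k t} equal) (sum-const (k t) A))

  A≢n² : A ≢ n * n
  A≢n² = <⇒≢ (subst (A <_) (trans (*-comm A (k t)) (sym n²≡kA)) (m<m*n A (k t) (atLeast2 t)))

  n²≤Aτ : n * n ≤ A * τ A
  n²≤Aτ = subst₂ _≤_ (sym n²≡kA) (*-comm (τ A) A) (*-monoˡ-≤ A (equal-areas⇒k≤τ t equal))
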